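{- Let $a,k\in\mathbb{N}\setminus\{1\}$, let $F=\{1,a,a^2,\dots,a^{k-1}\}$, and let $S(a,k)=\{n\in\mathbb{N}:\nu_a(n)\equiv k-1\pmod k\}$. Then $S(a,k)$ is multiplicatively $F$-syndetic and has natural density $d(S(a,k))=\frac{a-1}{a^k-1}$.
   Context: $\mathbb{N}=\{1,2,3,\dots\}$. For an integer $a\ge 2$, $\nu_a(n)=\max\{j\in\mathbb{N}\cup\{0\}:a^j\mid n\}$. For a non-empty finite $F\subset\mathbb{N}$, $S\subseteq\mathbb{N}$ is multiplicatively $F$-syndetic if for every $n\in\mathbb{N}$ there is $t\in F$ with $nt\in S$. The natural density of $A\subseteq\mathbb{N}$ is $d(A)=\lim_{N\to\infty}|A\cap\{1,\dots,N\}|/N$ (when the limit exists). -}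

module Defs where

open import Data.Nat as ℕ using (ℕ; zero; suc; _+_; _*_; _∸_; _^_; _≤_; _<_; ∣_-_∣)
open import Data.Nat.Divisibility using (_∣_; _∣?_; divides)
open import Data.Integer using (+_)
open import Data.Rational as ℚ using (ℚ; 0ℚ; _/_)
open import Data.List using (List; map; upTo)
open import Data.List.Membership.Propositional using (_∈_)
open import Data.Product using (Σ; ∃; _×_)
open import Relation.Nullary using (Dec; yes; no)
open import Relation.Unary using (Pred; Decidable)
open import Level using (0ℓ)

_≡_[mod_] : ℕ → ℕ → ℕ → Set
x ≡ y [mod k ] = k ∣ ∣ x - y ∣

-- ν_a(n) with fuel: strip factors a while they divide.
-- For a ≥ 2 and n ≥ 1, ν a n = max{ j : a^j ∣ n } (fuel n suffices since a^j ≤ n).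
νFuel : ℕ → ℕ → ℕ → ℕ
νFuel zero    a n = 0
νFuel (suc f) a zero = 0
νFuel (suc f) a (suc m) with a ∣? suc m
... | yes (divides q _) = suc (νFuel f a q)
... | no _ = 0

ν : ℕ → ℕ → ℕ
ν a n = νFuel n a n

Fpow : ℕ → ℕ → List ℕ
Fpow a k = map (a ^_) (upTo k)

S : ℕ → ℕ → Pred ℕ 0ℓ
S a k n = (1 ≤ n) × (ν a n ≡ k ∸ 1 [mod k ])

MultSyndetic : List ℕ → Pred ℕ 0ℓ → Set
MultSyndetic F A = ∀ n → 1 ≤ n → ∃ λ t → t ∈ F × A (n * t)

count : {A : Pred ℕ 0ℓ} → Decidable A → ℕ → ℕ
count A? zero = 0
count A? (suc N) with A? (suc N)
... | yes _ = suc (count A? N)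
... | no _ = count A? N

HasDensity : {A : Pred ℕ 0ℓ} → Decidable A → ℚ → Set
HasDensity A? L =
  ∀ (ε : ℚ) → 0ℚ ℚ.< ε →
    ∃ λ N₀ → ∀ N → N₀ ≤ N → ℚ.∣ (+ count A? (suc N) / suc N) ℚ.- L ∣ ℚ.< ε

-- p / q in ℚ for q ≠ 0 (only used with q ≠ 0)
frac : ℕ → ℕ → ℚ
frac p zero = 0ℚ
frac p (suc q) = + p / suc q

-- Multiplying n by a^j adds j to ν_a(n), so one of 1, a, …, a^(k−1) moves ν_a(n) into
-- the class k − 1 mod k.  For the density put b = a^k and c = a^(k−1), and write n = bs + r
-- with r < b.  If r = 0 then n ∈ S iff s ∈ S; otherwise ν_a(n) < k, so n ∈ S iff c ∣ r,
-- which happens for exactly a − 1 of the residues 0 < r < b.  Hence the counting function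
-- of S satisfies C(bs + r) = C(s) + (a − 1)s + #{0 < r′ ≤ r : c ∣ r′}, and the discrepancy
-- (b − 1)C(N) − (a − 1)N changes by a bounded amount per base-b digit of N.  Splitting off
-- a fixed number t of digits bounds it by O(t) + O(N / b^t), which is o(N).

module Submission where

open import Defs
open import Data.Nat using (ℕ; _≤_; _∸_; _^_)
open import Data.Product using (_×_; Σ)
open import Relation.Unary using (Decidable)

open import Data.Nat
open import Data.Nat.Properties
open import Data.Nat.DivMod
open import Data.Nat.Divisibility
open import Data.Nat.Tactic.RingSolver using (solve-∀)
open import Data.Integer as ℤ using (_⊖_)
import Data.Integer.Properties as ℤₚ
open import Data.Rational as ℚ using (ℚ; mkℚ; 0ℚ; toℚᵘ)
import Data.Rational.Properties as ℚₚ
open import Data.Rational.Unnormalised as ℚᵘ using (mkℚᵘ)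
import Data.Rational.Unnormalised.Properties as ℚᵘₚ
open import Data.Empty using (⊥-elim)
open import Data.Sum using (inj₁; inj₂; [_,_]′)
open import Data.Product using (∃; _,_)
open import Data.List.Membership.Propositional.Properties using (∈-map⁺; ∈-upTo⁺)
open import Function.Bundles using (_⇔_; mk⇔; Equivalence)
import Function.Properties.Equivalence as ⇔
open import Relation.Nullary using (Dec; yes; no; ¬_)
open import Relation.Nullary.Decidable using (_×-dec_)
open import Relation.Unary using (Pred)
open import Relation.Binary.PropositionalEquality
open import Level using (0ℓ)

-- The a-adic valuation

1+m≡q*a⇒q≤m : ∀ {a q m} → 2 ≤ a → suc m ≡ q * a → q ≤ m
1+m≡q*a⇒q≤m {q = zero} _ _ = z≤n
1+m≡q*a⇒q≤m {a} {suc q} {m} 2≤a@(s≤s (s≤s z≤n)) eq = s≤s⁻¹ (begin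
  2 + q      ≤⟨ +-monoʳ-≤ 2 (m≤m*n q a) ⟩
  2 + q * a  ≤⟨ +-monoˡ-≤ (q * a) 2≤a ⟩
  a + q * a  ≡⟨ sym eq ⟩
  suc m      ∎)
  where open ≤-Reasoning

νFuel-stable : ∀ {a} → 2 ≤ a → ∀ f g n → n ≤ f → n ≤ g → νFuel f a n ≡ νFuel g a n
νFuel-stable 2≤a zero    zero    n       _       _       = refl
νFuel-stable 2≤a zero    (suc g) zero    _       _       = refl
νFuel-stable 2≤a (suc f) zero    zero    _       _       = refl
νFuel-stable 2≤a (suc f) (suc g) zero    _       _       = refl
νFuel-stable {a} 2≤a (suc f) (suc g) (suc m) (s≤s m≤f) (s≤s m≤g) with a ∣? suc m
... | yes (divides q eq) = cong suc (νFuel-stable 2≤a f g q (≤-trans q≤m m≤f) (≤-trans q≤m m≤g))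
  where q≤m = 1+m≡q*a⇒q≤m 2≤a eq
... | no _ = refl

ν-suc : ∀ {a m q} → 2 ≤ a → suc m ≡ q * a → ν a (suc m) ≡ suc (ν a q)
ν-suc {a} {m} {q} 2≤a eq with a ∣? suc m
... | yes (divides q′ eq′) =
  cong suc (trans (cong (νFuel m a) q′≡q) (νFuel-stable 2≤a m q q (1+m≡q*a⇒q≤m 2≤a eq) ≤-refl))
  where
  instance a≢0 : NonZero a
           a≢0 = >-nonZero (<-trans z<s 2≤a)
  q′≡q : q′ ≡ q
  q′≡q = *-cancelʳ-≡ q′ q a (trans (sym eq′) eq)
... | no a∤ = ⊥-elim (a∤ (divides q eq))

ν-*a : ∀ {a m} → 2 ≤ a → 1 ≤ m → ν a (m * a) ≡ suc (ν a m)
ν-*a 2≤a@(s≤s (s≤s z≤n)) (s≤s z≤n) = ν-suc 2≤a refl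

ν-*-^ : ∀ {a m} → 2 ≤ a → 1 ≤ m → ∀ j → ν a (m * a ^ j) ≡ ν a m + j
ν-*-^ {a} {m} 2≤a 1≤m zero = trans (cong (ν a) (*-identityʳ m)) (sym (+-identityʳ (ν a m)))
ν-*-^ {a} {m} 2≤a 1≤m (suc j) = begin
  ν a (m * (a * a ^ j))  ≡⟨ cong (ν a) (*-comm-middle m a (a ^ j)) ⟩
  ν a (m * a ^ j * a)    ≡⟨ ν-*a 2≤a (*-mono-≤ 1≤m (m^n>0 a j)) ⟩
  suc (ν a (m * a ^ j))  ≡⟨ cong suc (ν-*-^ 2≤a 1≤m j) ⟩
  suc (ν a m + j)        ≡⟨ sym (+-suc (ν a m) j) ⟩
  ν a m + suc j          ∎
  where
  open ≡-Reasoning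
  instance a≢0 : NonZero a
           a≢0 = >-nonZero (<-trans z<s 2≤a)
  *-comm-middle : ∀ x y z → x * (y * z) ≡ x * z * y
  *-comm-middle = solve-∀

^νFuel∣ : ∀ f a n → a ^ νFuel f a n ∣ n
^νFuel∣ zero    a n = 1∣ n
^νFuel∣ (suc f) a zero = 1∣ 0
^νFuel∣ (suc f) a (suc m) with a ∣? suc m
... | yes (divides q eq) = subst (a * a ^ νFuel f a q ∣_) (trans (*-comm a q) (sym eq)) (*-monoʳ-∣ a (^νFuel∣ f a q))
... | no _ = 1∣ suc m

^-monoʳ-∣ : ∀ m {i j} → i ≤ j → m ^ i ∣ m ^ j
^-monoʳ-∣ m {i} {j} i≤j = divides (m ^ (j ∸ i)) (begin
  m ^ j                ≡⟨ cong (m ^_) (sym (m+[n∸m]≡n i≤j)) ⟩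
  m ^ (i + (j ∸ i))    ≡⟨ ^-distribˡ-+-* m i (j ∸ i) ⟩
  m ^ i * m ^ (j ∸ i)  ≡⟨ *-comm (m ^ i) _ ⟩
  m ^ (j ∸ i) * m ^ i  ∎)
  where open ≡-Reasoning

^∣⇔≤ν : ∀ {a n i} → 2 ≤ a → 1 ≤ n → a ^ i ∣ n ⇔ i ≤ ν a n
^∣⇔≤ν {a} {n} {i} 2≤a 1≤n = mk⇔ to from
  where
  to : a ^ i ∣ n → i ≤ ν a n
  to (divides w refl) = subst (i ≤_) (sym (ν-*-^ 2≤a (1≤w w 1≤n) i)) (m≤n+m i (ν a w))
    where
    1≤w : ∀ w → 1 ≤ w * a ^ i → 1 ≤ w
    1≤w (suc _) _ = s≤s z≤n
  from : i ≤ ν a n → a ^ i ∣ n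
  from i≤ν = ∣-trans (^-monoʳ-∣ a i≤ν) (^νFuel∣ n a n)

≡[mod]⇒%≡% : ∀ {k x y} .{{_ : NonZero k}} → x ≡ y [mod k ] → x % k ≡ y % k
≡[mod]⇒%≡% {k} {x} {y} k∣ = [ (λ y≤x → ≥-case y≤x k∣) , (λ x≤y → sym (≥-case x≤y (subst (k ∣_) (∣-∣-comm x y) k∣))) ]′ (≤-total y x)
  where
  ≥-case : ∀ {x y} → y ≤ x → x ≡ y [mod k ] → x % k ≡ y % k
  ≥-case {x} {y} y≤x k∣ = begin
    x % k              ≡⟨ %-congˡ (sym (m+[n∸m]≡n y≤x)) ⟩
    (y + (x ∸ y)) % k  ≡⟨ %-remove-+ʳ y (subst (k ∣_) (m≤n⇒∣n-m∣≡n∸m y≤x) k∣) ⟩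
    y % k              ∎
    where open ≡-Reasoning

%≡⇒≡[mod] : ∀ {k x y} .{{_ : NonZero k}} → x % k ≡ y → x ≡ y [mod k ]
%≡⇒≡[mod] {k} {x} {y} refl = divides (x / k) (begin
  ∣ x - x % k ∣                    ≡⟨ cong (∣_- x % k ∣) (m≡m%n+[m/n]*n x k) ⟩
  ∣ x % k + x / k * k - x % k ∣   ≡⟨ ∣-∣-comm (x % k + x / k * k) (x % k) ⟩
  ∣ x % k - x % k + x / k * k ∣   ≡⟨ ∣m-m+n∣≡n (x % k) (x / k * k) ⟩
  x / k * k                        ∎)
  where open ≡-Reasoning

-- Counting functions

m*[1+n]+0≡m*n+m : ∀ m n → m * suc n + 0 ≡ m * n + m
m*[1+n]+0≡m*n+m m n = trans (+-identityʳ (m * suc n)) (trans (*-suc m n) (+-comm m (m * n)))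

indicator : {P : Set} → Dec P → ℕ
indicator (yes _) = 1
indicator (no _)  = 0

indicator≤1 : {P : Set} (P? : Dec P) → indicator P? ≤ 1
indicator≤1 (yes _) = s≤s z≤n
indicator≤1 (no _)  = z≤n

indicator-yes : {P : Set} (P? : Dec P) → P → indicator P? ≡ 1
indicator-yes (yes _) _ = refl
indicator-yes (no ¬p) p = ⊥-elim (¬p p)

indicator-no : {P : Set} (P? : Dec P) → ¬ P → indicator P? ≡ 0
indicator-no (yes p) ¬p = ⊥-elim (¬p p)
indicator-no (no _)  _  = refl

indicator-cong : {P Q : Set} → P ⇔ Q → (P? : Dec P) (Q? : Dec Q) → indicator P? ≡ indicator Q?
indicator-cong P⇔Q (yes _) (yes _) = refl
indicator-cong P⇔Q (yes p) (no ¬q) = ⊥-elim (¬q (Equivalence.to P⇔Q p))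
indicator-cong P⇔Q (no ¬p) (yes q) = ⊥-elim (¬p (Equivalence.from P⇔Q q))
indicator-cong P⇔Q (no _)  (no _)  = refl

module _ {A : Pred ℕ 0ℓ} (A? : Decidable A) where

  count-suc : ∀ N → count A? (suc N) ≡ indicator (A? (suc N)) + count A? N
  count-suc N with A? (suc N)
  ... | yes _ = refl
  ... | no _  = refl

  count-+-suc : ∀ n r → count A? (n + suc r) ≡ indicator (A? (n + suc r)) + count A? (n + r)
  count-+-suc n r rewrite +-suc n r = count-suc (n + r)

  count≤ : ∀ N → count A? N ≤ N
  count≤ zero    = z≤n
  count≤ (suc N) = subst (_≤ suc N) (sym (count-suc N)) (+-mono-≤ (indicator≤1 (A? (suc N))) (count≤ N))

  count-mono : ∀ {M N} → M ≤ N → count A? M ≤ count A? N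
  count-mono {N = zero}  z≤n = z≤n
  count-mono {M} {suc N} M≤1+N with m≤n⇒m<n∨m≡n M≤1+N
  ... | inj₁ M<1+N = ≤-trans (count-mono (s≤s⁻¹ M<1+N)) (subst (count A? N ≤_) (sym (count-suc N)) (m≤n+m _ _))
  ... | inj₂ refl  = ≤-refl

-- Induction along the enumeration (s, r) ↦ (q + 1)s + r of the pairs with r ≤ q.
digit-induction : (P : ℕ → ℕ → Set) (q : ℕ) → P 0 0 →
                  (∀ s r → r < q → P s r → P s (suc r)) → (∀ s → P s q → P (suc s) 0) →
                  ∀ s r → r ≤ q → P s r
digit-induction P q base step carry = go
  where
  go : ∀ s r → r ≤ q → P s r
  go zero    zero    _   = base
  go (suc s) zero    _   = carry s (go s q ≤-refl)
  go s       (suc r) r<q = step s r r<q (go s r (<⇒≤ r<q))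

count-∣ : ∀ c .{{_ : NonZero c}} t r → r < c → count (c ∣?_) (c * t + r) ≡ t
count-∣ c@(suc c′) t r r<c = digit-induction (λ t r → D (c * t + r) ≡ t) c′ base step carry t r (s≤s⁻¹ r<c)
  where
  open ≡-Reasoning
  D : ℕ → ℕ
  D = count (c ∣?_)
  base : D (c * 0 + 0) ≡ 0
  base = cong D (trans (+-identityʳ (c * 0)) (*-zeroʳ c))
  step : ∀ s r → r < c′ → D (c * s + r) ≡ s → D (c * s + suc r) ≡ s
  step s r r<c′ ih = begin
    D (c * s + suc r)                                   ≡⟨ count-+-suc (c ∣?_) (c * s) r ⟩
    indicator (c ∣? (c * s + suc r)) + D (c * s + r)    ≡⟨ cong₂ _+_ (indicator-no (c ∣? _) c∤) ih ⟩
    s                                                   ∎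
    where
    c∤ : ¬ c ∣ c * s + suc r
    c∤ c∣ = <⇒≱ (s≤s r<c′) (∣⇒≤ (∣m+n∣m⇒∣n c∣ (m∣m*n s)))
  carry : ∀ s → D (c * s + c′) ≡ s → D (c * suc s + 0) ≡ suc s
  carry s ih = begin
    D (c * suc s + 0)                                   ≡⟨ cong D (m*[1+n]+0≡m*n+m c s) ⟩
    D (c * s + c)                                       ≡⟨ count-+-suc (c ∣?_) (c * s) c′ ⟩
    indicator (c ∣? (c * s + c)) + D (c * s + c′)       ≡⟨ cong₂ _+_ (indicator-yes (c ∣? _) (∣m∣n⇒∣m+n (m∣m*n s) ∣-refl)) ih ⟩
    suc s                                               ∎

-- Rational approximation

∣m⊖n∣≡∣m-n∣ : ∀ m n → ℤ.∣ m ⊖ n ∣ ≡ ∣ m - n ∣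
∣m⊖n∣≡∣m-n∣ m n with ≤-total m n
... | inj₁ m≤n = trans (ℤₚ.∣⊖∣-≤ m≤n) (sym (m≤n⇒∣m-n∣≡n∸m m≤n))
... | inj₂ n≤m = trans (cong ℤ.∣_∣ (ℤₚ.⊖-≥ n≤m)) (sym (m≤n⇒∣n-m∣≡n∸m n≤m))

+m*+n-+o*+p≡m*n⊖o*p : ∀ m n o p → ℤ.+ m ℤ.* ℤ.+ n ℤ.+ ℤ.- ℤ.+ o ℤ.* ℤ.+ p ≡ (m * n) ⊖ (o * p)
+m*+n-+o*+p≡m*n⊖o*p m n o p = begin
  ℤ.+ m ℤ.* ℤ.+ n ℤ.+ ℤ.- ℤ.+ o ℤ.* ℤ.+ p  ≡⟨ cong₂ ℤ._+_ (sym (ℤₚ.pos-* m n)) (sym (ℤₚ.neg-distribˡ-* (ℤ.+ o) (ℤ.+ p))) ⟩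
  ℤ.+ (m * n) ℤ.+ ℤ.- (ℤ.+ o ℤ.* ℤ.+ p)    ≡⟨ cong (λ z → ℤ.+ (m * n) ℤ.- z) (sym (ℤₚ.pos-* o p)) ⟩
  ℤ.+ (m * n) ℤ.- ℤ.+ (o * p)              ≡⟨ ℤₚ.[+m]-[+n]≡m⊖n (m * n) (o * p) ⟩
  (m * n) ⊖ (o * p)                        ∎
  where open ≡-Reasoning

∣x/m-y/n∣<ᵘ : ∀ x m y n d e → suc d * ∣ x * suc n - y * suc m ∣ < suc m * suc n →
              ℚᵘ.∣ mkℚᵘ (ℤ.+ x) m ℚᵘ.- mkℚᵘ (ℤ.+ y) n ∣ ℚᵘ.< mkℚᵘ (ℤ.+ suc e) d
∣x/m-y/n∣<ᵘ x m y n d e close = ℚᵘ.*<* (subst₂ ℤ._<_ (ℤₚ.pos-* A (suc d)) (ℤₚ.pos-* (suc e) (suc m * suc n)) (ℤ.+<+ A*d<e*mn))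
  where
  A : ℕ
  A = ℤ.∣ ℤ.+ x ℤ.* ℤ.+ suc n ℤ.+ ℤ.- ℤ.+ y ℤ.* ℤ.+ suc m ∣
  A≡ : A ≡ ∣ x * suc n - y * suc m ∣
  A≡ = trans (cong ℤ.∣_∣ (+m*+n-+o*+p≡m*n⊖o*p x (suc n) y (suc m))) (∣m⊖n∣≡∣m-n∣ (x * suc n) (y * suc m))
  A*d<e*mn : A * suc d < suc e * (suc m * suc n)
  A*d<e*mn = begin-strict
    A * suc d                       ≡⟨ cong (_* suc d) A≡ ⟩
    ∣ x * suc n - y * suc m ∣ * suc d  ≡⟨ *-comm _ (suc d) ⟩
    suc d * ∣ x * suc n - y * suc m ∣  <⟨ close ⟩
    suc m * suc n                   ≤⟨ m≤n*m (suc m * suc n) (suc e) ⟩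
    suc e * (suc m * suc n)         ∎
    where open ≤-Reasoning

toℚᵘ-∣x/m-y/n∣ : ∀ x m y n → toℚᵘ (ℚ.∣ ℤ.+ x ℚ./ suc m ℚ.- ℤ.+ y ℚ./ suc n ∣) ℚᵘ.≃ ℚᵘ.∣ mkℚᵘ (ℤ.+ x) m ℚᵘ.- mkℚᵘ (ℤ.+ y) n ∣
toℚᵘ-∣x/m-y/n∣ x m y n =
  ℚᵘₚ.≃-trans (ℚₚ.toℚᵘ-homo-∣-∣ (X ℚ.- Y)) (ℚᵘₚ.∣-∣-cong
    (ℚᵘₚ.≃-trans (ℚₚ.toℚᵘ-homo-+ X (ℚ.- Y))
      (ℚᵘₚ.+-cong (ℚₚ.toℚᵘ-fromℚᵘ (mkℚᵘ (ℤ.+ x) m))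
        (ℚᵘₚ.≃-trans (ℚₚ.toℚᵘ-homo‿- Y) (ℚᵘₚ.-‿cong (ℚₚ.toℚᵘ-fromℚᵘ (mkℚᵘ (ℤ.+ y) n)))))))
  where
  X Y : ℚ
  X = ℤ.+ x ℚ./ suc m
  Y = ℤ.+ y ℚ./ suc n

ℚ-approx : ∀ ε → 0ℚ ℚ.< ε → ∃ λ d → ∀ x m y n → suc d * ∣ x * suc n - y * suc m ∣ < suc m * suc n →
           ℚ.∣ ℤ.+ x ℚ./ suc m ℚ.- ℤ.+ y ℚ./ suc n ∣ ℚ.< ε
-- For ε = (e + 1)/(d + 1) the hypothesis bounds the distance by 1/(d + 1) ≤ ε.
ℚ-approx (mkℚ (ℤ.+ suc e) d _) _ = d , λ x m y n close →
  ℚₚ.toℚᵘ-cancel-< (ℚᵘₚ.<-respˡ-≃ (ℚᵘₚ.≃-sym (toℚᵘ-∣x/m-y/n∣ x m y n)) (∣x/m-y/n∣<ᵘ x m y n d e close))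
ℚ-approx (mkℚ (ℤ.+ zero)   _ _) (ℚ.*<* (ℤ.+<+ ()))
ℚ-approx (mkℚ ℤ.-[1+ _ ] _ _) (ℚ.*<* ())

sublinear-error⇒density : ∀ {A : Pred ℕ 0ℓ} (A? : Decidable A) p q .{{_ : NonZero q}} →
  (∀ d → ∃ λ N₀ → ∀ N → N₀ < N → suc d * ∣ count A? N * q - p * N ∣ < N) →
  HasDensity A? (frac p q)
sublinear-error⇒density A? p (suc q) sublinear ε 0<ε with ℚ-approx ε 0<ε
... | d , approx with sublinear d
...   | N₀ , small = N₀ , λ N N₀≤N →
  approx (count A? (suc N)) N p q (≤-trans (small (suc N) (s≤s N₀≤N)) (m≤m*n (suc N) (suc q)))

-- Counting functions satisfying a base-b digit recurrence

∣m+n-o+p∣≤∣m-o∣+∣n-p∣ : ∀ m n o p → ∣ m + n - o + p ∣ ≤ ∣ m - o ∣ + ∣ n - p ∣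
∣m+n-o+p∣≤∣m-o∣+∣n-p∣ m n o p = begin
  ∣ m + n - o + p ∣                  ≤⟨ ∣-∣-triangle (m + n) (o + n) (o + p) ⟩
  ∣ m + n - o + n ∣ + ∣ o + n - o + p ∣  ≡⟨ cong₂ _+_ (trans (cong₂ ∣_-_∣ (+-comm m n) (+-comm o n)) (∣m+n-m+o∣≡∣n-o∣ n m o))
                                                     (∣m+n-m+o∣≡∣n-o∣ o n p) ⟩
  ∣ m - o ∣ + ∣ n - p ∣              ∎
  where open ≤-Reasoning

n<m^n : ∀ {m} → 1 < m → ∀ n → n < m ^ n
n<m^n 1<m zero    = s≤s z≤n
n<m^n {m} 1<m (suc n) = ≤-<-trans (n<m^n 1<m n) (^-monoʳ-< m 1<m (n<1+n n))

module DigitRecurrence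
  {A : Pred ℕ 0ℓ} (A? : Decidable A) (b p : ℕ) (1<b : 1 < b) (D : ℕ → ℕ)
  (recurrence : ∀ s r → r < b → count A? (b * s + r) ≡ count A? s + p * s + D r)
  (D≤p : ∀ r → r < b → D r ≤ p)
  where

  private
    instance
      b≢0 : NonZero b
      b≢0 = >-nonZero (<-trans z<s 1<b)
    C : ℕ → ℕ
    C = count A?
    q : ℕ
    q = b ∸ 1

  error : ℕ → ℕ
  error N = ∣ C N * q - p * N ∣

  error-digit : ∀ N → error N ≤ error (N / b) + p * q
  error-digit N = begin
    ∣ C N * q - p * N ∣                                         ≡⟨ cong₂ (λ x y → ∣ x * q - p * y ∣) C≡ N≡ ⟩
    ∣ (C s + p * s + D r) * q - p * (suc q * s + r) ∣           ≡⟨ cong₂ ∣_-_∣ (expand₁ (C s) p s (D r) q) (expand₂ p q s r) ⟩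
    ∣ p * s * q + (C s * q + D r * q) - p * s * q + (p * s + p * r) ∣  ≡⟨ ∣m+n-m+o∣≡∣n-o∣ (p * s * q) _ _ ⟩
    ∣ C s * q + D r * q - p * s + p * r ∣                       ≤⟨ ∣m+n-o+p∣≤∣m-o∣+∣n-p∣ (C s * q) (D r * q) (p * s) (p * r) ⟩
    error s + ∣ D r * q - p * r ∣                               ≤⟨ +-monoʳ-≤ (error s) (≤-trans (∣m-n∣≤m⊔n (D r * q) (p * r)) (⊔-lub Dr*q≤p*q p*r≤p*q)) ⟩
    error s + p * q                                             ∎
    where
    open ≤-Reasoning
    s r : ℕ
    s = N / b
    r = N % b
    r<b : r < b
    r<b = m%n<n N b
    N≡ : N ≡ suc q * s + r
    N≡ = trans (m≡m%n+[m/n]*n N b) (trans (+-comm r (s * b)) (cong (_+ r) (trans (*-comm s b) (cong (_* s) (sym (suc-pred b))))))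
    C≡ : C N ≡ C s + p * s + D r
    C≡ = trans (cong C (trans N≡ (cong (λ x → x * s + r) (suc-pred b)))) (recurrence s r r<b)
    Dr*q≤p*q : D r * q ≤ p * q
    Dr*q≤p*q = *-monoˡ-≤ q (D≤p r r<b)
    p*r≤p*q : p * r ≤ p * q
    p*r≤p*q = *-monoʳ-≤ p (<⇒≤pred r<b)
    expand₁ : ∀ x p s y q → (x + p * s + y) * q ≡ p * s * q + (x * q + y * q)
    expand₁ = solve-∀
    expand₂ : ∀ p q s r → p * (suc q * s + r) ≡ p * s * q + (p * s + p * r)
    expand₂ = solve-∀

  error-base : ∀ N s → N ≤ s → error N ≤ (p + q) * s
  error-base N s N≤s = begin
    ∣ C N * q - p * N ∣  ≤⟨ ∣m-n∣≤m⊔n (C N * q) (p * N) ⟩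
    C N * q ⊔ p * N      ≤⟨ m⊔n≤m+n (C N * q) (p * N) ⟩
    C N * q + p * N      ≤⟨ +-mono-≤ (*-monoˡ-≤ q (≤-trans (count≤ A? N) N≤s)) (*-monoʳ-≤ p N≤s) ⟩
    s * q + p * s        ≡⟨ regroup s q p ⟩
    (p + q) * s          ∎
    where
    open ≤-Reasoning
    regroup : ∀ s q p → s * q + p * s ≡ (p + q) * s
    regroup = solve-∀

  error-bound : ∀ t N s → N < b ^ t * suc s → error N ≤ t * (p * q) + (p + q) * s
  error-bound zero    N s N<b⁰[1+s] = error-base N s (s≤s⁻¹ (subst (N <_) (*-identityˡ (suc s)) N<b⁰[1+s]))
  error-bound (suc t) N s N<bᵗ⁺¹[1+s] = begin
    error N                                    ≤⟨ error-digit N ⟩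
    error (N / b) + p * q                      ≤⟨ +-monoˡ-≤ (p * q) (error-bound t (N / b) s (m<n*o⇒m/o<n N<bᵗ[1+s]*b)) ⟩
    t * (p * q) + (p + q) * s + p * q          ≡⟨ +-comm-last (t * (p * q)) ((p + q) * s) (p * q) ⟩
    suc t * (p * q) + (p + q) * s              ∎
    where
    open ≤-Reasoning
    N<bᵗ[1+s]*b : N < b ^ t * suc s * b
    N<bᵗ[1+s]*b = subst (N <_) (rotate b (b ^ t) (suc s)) N<bᵗ⁺¹[1+s]
      where
      rotate : ∀ x y z → x * y * z ≡ y * z * x
      rotate = solve-∀
    +-comm-last : ∀ x y z → x + y + z ≡ z + x + y
    +-comm-last = solve-∀

  error-sublinear : ∀ d → ∃ λ N₀ → ∀ N → N₀ < N → suc d * error N < N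
  error-sublinear d = N₀ , bound
    where
    -- Split off t digits; t and N₀ make both terms of error-bound at most N / 2(d + 1).
    t N₀ : ℕ
    t = 2 * suc d * (p + q)
    N₀ = 2 * suc d * (t * (p * q))
    bound : ∀ N → N₀ < N → suc d * error N < N
    bound N N₀<N = *-cancelˡ-< 2 _ _ (begin-strict
      2 * (suc d * error N)                              ≤⟨ *-monoʳ-≤ 2 (*-monoʳ-≤ (suc d) (error-bound t N s N<bᵗ[1+s])) ⟩
      2 * (suc d * (t * (p * q) + (p + q) * s))          ≡⟨ distribute (suc d) p q s t ⟩
      N₀ + t * s                                         ≤⟨ +-monoʳ-≤ N₀ (*-monoˡ-≤ s (<⇒≤ (n<m^n 1<b t))) ⟩
      N₀ + bᵗ * s                                        ≤⟨ +-monoʳ-≤ N₀ (subst (_≤ N) (*-comm s bᵗ) (m/n*n≤m N bᵗ)) ⟩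
      N₀ + N                                             <⟨ +-monoˡ-< N N₀<N ⟩
      N + N                                              ≡⟨ cong (N +_) (sym (+-identityʳ N)) ⟩
      2 * N                                              ∎)
      where
      open ≤-Reasoning
      bᵗ s : ℕ
      bᵗ = b ^ t
      instance
        bᵗ≢0 : NonZero bᵗ
        bᵗ≢0 = m^n≢0 b t
      s = N / bᵗ
      N<bᵗ[1+s] : N < bᵗ * suc s
      N<bᵗ[1+s] = begin-strict
        N                 ≡⟨ m≡m%n+[m/n]*n N bᵗ ⟩
        N % bᵗ + s * bᵗ   <⟨ +-monoˡ-< (s * bᵗ) (m%n<n N bᵗ) ⟩
        bᵗ + s * bᵗ       ≡⟨ cong (bᵗ +_) (*-comm s bᵗ) ⟩
        bᵗ + bᵗ * s       ≡⟨ sym (*-suc bᵗ s) ⟩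
        bᵗ * suc s        ∎
      distribute : ∀ e p q s t → 2 * (e * (t * (p * q) + (p + q) * s)) ≡ 2 * e * (t * (p * q)) + 2 * e * (p + q) * s
      distribute = solve-∀

  density : HasDensity A? (frac p q)
  density = sublinear-error⇒density A? p q {{>-nonZero (∸-monoˡ-≤ 1 1<b)}} error-sublinear

-- The set S(a, k)

S? : ∀ a k → Decidable (S a k)
S? a k n = (1 ≤? n) ×-dec (k ∣? ∣ ν a n - k ∸ 1 ∣)

pred[m*n]≡n*pred[m]+pred[n] : ∀ m n .{{_ : NonZero m}} .{{_ : NonZero n}} → m * n ∸ 1 ≡ n * (m ∸ 1) + (n ∸ 1)
pred[m*n]≡n*pred[m]+pred[n] (suc m) (suc n) = regroup m n
  where
  regroup : ∀ m n → n + m * suc n ≡ suc n * m + n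
  regroup = solve-∀

module _ (a k : ℕ) (2≤a : 2 ≤ a) {{_ : NonZero k}} where

  private
    instance
      a≢0 : NonZero a
      a≢0 = >-nonZero (<-trans z<s 2≤a)
    b c p : ℕ
    b = a ^ k
    c = a ^ (k ∸ 1)
    p = a ∸ 1
    instance
      b≢0 : NonZero b
      b≢0 = m^n≢0 a k
      c≢0 : NonZero c
      c≢0 = m^n≢0 a (k ∸ 1)
    C D : ℕ → ℕ
    C = count (S? a k)
    D = count (c ∣?_)
    k∸1<k : k ∸ 1 < k
    k∸1<k = m≤pred[n]⇒suc[m]≤n ≤-refl

  S⇔ν%k≡k∸1 : ∀ {n} → 1 ≤ n → S a k n ⇔ ν a n % k ≡ k ∸ 1
  S⇔ν%k≡k∸1 1≤n = mk⇔ (λ (_ , ν≡k∸1) → trans (≡[mod]⇒%≡% ν≡k∸1) (m<n⇒m%n≡m k∸1<k))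
                      (λ ν%k≡k∸1 → 1≤n , %≡⇒≡[mod] ν%k≡k∸1)

  S-syndetic : MultSyndetic (Fpow a k) (S a k)
  S-syndetic n 1≤n = a ^ j , ∈-map⁺ (a ^_) (∈-upTo⁺ j<k) , Equivalence.from (S⇔ν%k≡k∸1 (*-mono-≤ 1≤n (m^n>0 a j))) ν%k≡k∸1
    where
    v j : ℕ
    v = ν a n
    j = (k ∸ 1) ∸ v % k
    j<k : j < k
    j<k = ≤-<-trans (m∸n≤m (k ∸ 1) (v % k)) k∸1<k
    ν%k≡k∸1 : ν a (n * a ^ j) % k ≡ k ∸ 1
    ν%k≡k∸1 = begin
      ν a (n * a ^ j) % k  ≡⟨ cong (_% k) (ν-*-^ 2≤a 1≤n j) ⟩
      (v + j) % k          ≡⟨ %-distribˡ-+ v j k ⟩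
      (v % k + j % k) % k  ≡⟨ cong (λ z → (v % k + z) % k) (m<n⇒m%n≡m j<k) ⟩
      (v % k + j) % k      ≡⟨ %-congˡ (m+[n∸m]≡n (<⇒≤pred (m%n<n v k))) ⟩
      (k ∸ 1) % k          ≡⟨ m<n⇒m%n≡m k∸1<k ⟩
      k ∸ 1                ∎
      where open ≡-Reasoning

  S-scale : ∀ {m} → 1 ≤ m → S a k (b * m) ⇔ S a k m
  S-scale {m} 1≤m = ⇔.trans (subst (λ x → S a k (b * m) ⇔ x ≡ k ∸ 1) ν[b*m]%k≡ν[m]%k (S⇔ν%k≡k∸1 1≤b*m)) (⇔.sym (S⇔ν%k≡k∸1 1≤m))
    where
    1≤b*m : 1 ≤ b * m
    1≤b*m = *-mono-≤ (m^n>0 a k) 1≤m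
    ν[b*m]%k≡ν[m]%k : ν a (b * m) % k ≡ ν a m % k
    ν[b*m]%k≡ν[m]%k = begin
      ν a (b * m) % k    ≡⟨ cong (λ x → ν a x % k) (*-comm b m) ⟩
      ν a (m * b) % k    ≡⟨ cong (_% k) (ν-*-^ 2≤a 1≤m k) ⟩
      (ν a m + k) % k    ≡⟨ [m+n]%n≡m%n (ν a m) k ⟩
      ν a m % k          ∎
      where open ≡-Reasoning

  S-digit : ∀ s {r} → 1 ≤ r → r < b → S a k (b * s + r) ⇔ c ∣ r
  S-digit s {r} 1≤r r<b = mk⇔ to from
    where
    n : ℕ
    n = b * s + r
    1≤n : 1 ≤ n
    1≤n = ≤-trans 1≤r (m≤n+m r (b * s))
    c∣b*s : c ∣ b * s
    c∣b*s = ∣m⇒∣m*n s (^-monoʳ-∣ a (m∸n≤m k 1))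
    ν<k : ν a n < k
    ν<k = ≰⇒> λ k≤ν → <⇒≱ r<b (∣⇒≤ {{>-nonZero 1≤r}} (∣m+n∣m⇒∣n (Equivalence.from (^∣⇔≤ν 2≤a 1≤n) k≤ν) (m∣m*n s)))
    ν%k≡ν : ν a n % k ≡ ν a n
    ν%k≡ν = m<n⇒m%n≡m ν<k
    to : S a k n → c ∣ r
    to Sn = ∣m+n∣m⇒∣n (Equivalence.from (^∣⇔≤ν 2≤a 1≤n) (≤-reflexive (trans (sym (Equivalence.to (S⇔ν%k≡k∸1 1≤n) Sn)) ν%k≡ν))) c∣b*s
    from : c ∣ r → S a k n
    from c∣r = Equivalence.from (S⇔ν%k≡k∸1 1≤n)
      (trans ν%k≡ν (≤-antisym (<⇒≤pred ν<k) (Equivalence.to (^∣⇔≤ν 2≤a 1≤n) (∣m∣n⇒∣m+n c∣b*s c∣r))))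

  private
    D[b∸1]≡p : D (b ∸ 1) ≡ p
    D[b∸1]≡p = begin
      D (b ∸ 1)                  ≡⟨ cong (λ x → D (a ^ x ∸ 1)) (sym (suc-pred k)) ⟩
      D (a * c ∸ 1)              ≡⟨ cong D (pred[m*n]≡n*pred[m]+pred[n] a c) ⟩
      D (c * p + (c ∸ 1))        ≡⟨ count-∣ c p (c ∸ 1) (m≤pred[n]⇒suc[m]≤n ≤-refl) ⟩
      p                          ∎
      where open ≡-Reasoning

    D≤p : ∀ r → r < b → D r ≤ p
    D≤p r r<b = subst (D r ≤_) D[b∸1]≡p (count-mono (c ∣?_) (<⇒≤pred r<b))

  S-recurrence : ∀ s r → r < b → C (b * s + r) ≡ C s + p * s + D r
  S-recurrence s r r<b = digit-induction (λ s r → C (b * s + r) ≡ C s + p * s + D r) (b ∸ 1) base step carry s r (<⇒≤pred r<b)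
    where
    open ≡-Reasoning
    base : C (b * 0 + 0) ≡ C 0 + p * 0 + D 0
    base = trans (cong C (trans (+-identityʳ (b * 0)) (*-zeroʳ b))) (sym (cong (_+ 0) (*-zeroʳ p)))
    step : ∀ s r → r < b ∸ 1 → C (b * s + r) ≡ C s + p * s + D r → C (b * s + suc r) ≡ C s + p * s + D (suc r)
    step s r r<b∸1 ih = begin
      C (b * s + suc r)                                     ≡⟨ count-+-suc (S? a k) (b * s) r ⟩
      indicator (S? a k (b * s + suc r)) + C (b * s + r)    ≡⟨ cong₂ _+_ (indicator-cong (S-digit s (s≤s z≤n) (m≤pred[n]⇒suc[m]≤n r<b∸1)) _ (c ∣? suc r)) ih ⟩
      indicator (c ∣? suc r) + (C s + p * s + D r)          ≡⟨ +-comm-left (indicator (c ∣? suc r)) (C s + p * s) (D r) ⟩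
      C s + p * s + (indicator (c ∣? suc r) + D r)          ≡⟨ cong (C s + p * s +_) (sym (count-suc (c ∣?_) r)) ⟩
      C s + p * s + D (suc r)                               ∎
      where
      +-comm-left : ∀ x y z → x + (y + z) ≡ y + (x + z)
      +-comm-left = solve-∀
    carry : ∀ s → C (b * s + (b ∸ 1)) ≡ C s + p * s + D (b ∸ 1) → C (b * suc s + 0) ≡ C (suc s) + p * suc s + D 0
    carry s ih = begin
      C (b * suc s + 0)                                     ≡⟨ cong C b*[1+s]+0≡b*s+[1+[b∸1]] ⟩
      C (b * s + suc (b ∸ 1))                               ≡⟨ count-+-suc (S? a k) (b * s) (b ∸ 1) ⟩
      indicator (S? a k (b * s + suc (b ∸ 1))) + C (b * s + (b ∸ 1))  ≡⟨ cong₂ _+_ ind≡ (trans ih (cong (λ x → C s + p * s + x) D[b∸1]≡p)) ⟩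
      indicator (S? a k (suc s)) + (C s + p * s + p)        ≡⟨ regroup (indicator (S? a k (suc s))) (C s) p s ⟩
      indicator (S? a k (suc s)) + C s + p * suc s + 0      ≡⟨ cong (λ x → x + p * suc s + 0) (sym (count-suc (S? a k) s)) ⟩
      C (suc s) + p * suc s + D 0                           ∎
      where
      b*[1+s]+0≡b*s+[1+[b∸1]] : b * suc s + 0 ≡ b * s + suc (b ∸ 1)
      b*[1+s]+0≡b*s+[1+[b∸1]] = trans (m*[1+n]+0≡m*n+m b s) (cong (b * s +_) (sym (suc-pred b)))
      ind≡ : indicator (S? a k (b * s + suc (b ∸ 1))) ≡ indicator (S? a k (suc s))
      ind≡ = trans (cong (λ x → indicator (S? a k x)) (sym b*[1+s]+0≡b*s+[1+[b∸1]]))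
                   (trans (cong (λ x → indicator (S? a k x)) (+-identityʳ (b * suc s)))
                          (indicator-cong (S-scale (s≤s z≤n)) _ _))
      regroup : ∀ i x p s → i + (x + p * s + p) ≡ i + x + p * suc s + 0
      regroup = solve-∀

  S-density : HasDensity (S? a k) (frac p (b ∸ 1))
  S-density = DigitRecurrence.density (S? a k) b p (^-monoʳ-< a 2≤a (>-nonZero⁻¹ k)) D S-recurrence D≤p

lemma3p3 : (a k : ℕ) → 2 ≤ a → 2 ≤ k →
    MultSyndetic (Fpow a k) (S a k) ×
    Σ (Decidable (S a k)) (λ S? → HasDensity S? (frac (a ∸ 1) (a ^ k ∸ 1)))
lemma3p3 a k 2≤a 2≤k = S-syndetic a k 2≤a , S? a k , S-density a k 2≤a
  where
  instance
    k≢0 : NonZero k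
    k≢0 = >-nonZero (<-trans z<s 2≤k)
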